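{- Let $m,n$ be integers with $2\leq 2m<n<3m$. Then there is a Latin trade $T_{m,n}$ in $B_n$ such that $T_0:=\{(0,0;0),(m,0;m),(m,m;2m),(m,n-m;0)\}\subseteq T_{m,n}$, and every $(r,c;r+c)\in T_{m,n}\setminus T_0$ satisfies $0\leq r\leq 3m-n$ and $m\leq c\leq n-m$.
   Context: $B_n=\{(i,j;i+j \bmod n): i,j\in\mathbb{Z}_n\}$ is the addition table of $\mathbb{Z}_n$, as triples (row, column; symbol), with rows and columns identified with $\{0,1,\dots,n-1\}$ and symbols taken mod $n$. A partial Latin square (PLS) is an array in which some cells may be empty and each symbol occurs at most once per row and column. A Latin trade in $B_n$ is a non-empty PLS $T\subseteq B_n$ for which there is a PLS $T'$ of the same order with $T\cap T'=\emptyset$, the same set of non-empty cells as $T$, and the same set of symbols as $T$ in each row and in each column. -}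

module Defs where

open import Data.Nat using (ℕ; _+_; _≤_; _%_; NonZero)
open import Data.Fin using (Fin; toℕ)
open import Data.Product using (_×_; _,_; ∃; Σ)
open import Data.List using (List; [])
open import Data.Sum using (_⊎_)
open import Data.List.Membership.Propositional using (_∈_; _∉_)
open import Data.List.Relation.Unary.Unique.Propositional using (Unique)
open import Relation.Binary.PropositionalEquality using (_≡_; _≢_)
open import Relation.Nullary using (¬_)

Triple : ℕ → Set
Triple n = Fin n × Fin n × Fin n

row col sym : ∀ {n} → Triple n → Fin n
row (r , c , s) = r
col (r , c , s) = c
sym (r , c , s) = s

-- A finite set of triples is represented by a duplicate-free list.
-- Partial Latin square: each cell holds at most one symbol, and each symbol
-- occurs at most once per row and per column.
record IsPLS {n : ℕ} (P : List (Triple n)) : Set where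
  field
    unique   : Unique P
    cell     : ∀ {t u} → t ∈ P → u ∈ P → row t ≡ row u → col t ≡ col u → sym t ≡ sym u
    rowSym   : ∀ {t u} → t ∈ P → u ∈ P → row t ≡ row u → sym t ≡ sym u → col t ≡ col u
    colSym   : ∀ {t u} → t ∈ P → u ∈ P → col t ≡ col u → sym t ≡ sym u → row t ≡ row u

-- Membership of a triple in B_n, the addition table of Z_n:
-- s ≡ r + c (mod n).  Since r, c, s < n, this means r + c = s or r + c = s + n.
InB : (n : ℕ) → Triple n → Set
InB n (r , c , s) = (toℕ r + toℕ c ≡ toℕ s) ⊎ (toℕ r + toℕ c ≡ toℕ s + n)

record IsLatinTradeInB (n : ℕ) (T : List (Triple n)) : Set where
  field
    nonEmpty : ¬ (T ≡ [])
    inB      : ∀ {t} → t ∈ T → InB n t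
    pls      : IsPLS T
    mate     : List (Triple n)
    matePLS  : IsPLS mate
    disjoint : ∀ {t} → t ∈ T → t ∉ mate
    cells    : ∀ r c → (∃ λ s → (r , c , s) ∈ T) → (∃ λ s → (r , c , s) ∈ mate)
    cells'   : ∀ r c → (∃ λ s → (r , c , s) ∈ mate) → (∃ λ s → (r , c , s) ∈ T)
    rows     : ∀ r s → (∃ λ c → (r , c , s) ∈ T) → (∃ λ c → (r , c , s) ∈ mate)
    rows'    : ∀ r s → (∃ λ c → (r , c , s) ∈ mate) → (∃ λ c → (r , c , s) ∈ T)
    cols     : ∀ c s → (∃ λ r → (r , c , s) ∈ T) → (∃ λ r → (r , c , s) ∈ mate)
    cols'    : ∀ c s → (∃ λ r → (r , c , s) ∈ mate) → (∃ λ r → (r , c , s) ∈ T)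

-- The triple with row r and column c (given as naturals) belongs to T.
-- (Its symbol is then determined as (r+c) mod n by membership in B_n.)
HasCell : ∀ {n} → List (Triple n) → ℕ → ℕ → Set
HasCell {n} T r c = ∃ λ (t : Triple n) → t ∈ T × toℕ (row t) ≡ r × toℕ (col t) ≡ c

{-# OPTIONS --safe #-}
-- Write m = k + l and n = 2m + l, so that k = 3m − n ≥ 1 and l = n − 2m ≥ 1, and write (i,j) ↦ t for
-- the cell (i,j), holding i + j, with mate symbol t.  The trade is T₀ together with a copy, shifted
-- right by m columns, of a "defect trade" D on the rectangle [0,k] × [0,l] of the addition table of ℕ:
-- a Latin bitrade there except for the cells (0,0) and (k,l), the mate k + l and an extra mate ⋆
-- (which becomes 0 in B_n); the four cells of T₀ repair exactly these defects.  Defect trades exist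
-- for all k ≥ 0, l ≥ 1 by the subtractive Euclidean algorithm: for k = 0 take (0,0) ↦ l, (0,l) ↦ ⋆;
-- for k ≥ l add (k,0) ↦ k + l and (k,l) ↦ k to a defect trade for (k − l, l); for k < l add the
-- column (0,l) ↦ ⋆, (k,l) ↦ l to a defect trade for (k, l − k) whose mates are relabelled
-- ⋆ ↦ l ↦ k + l.
module Submission where

open import Defs renaming (sym to symbol)
open import Data.Nat using (ℕ; zero; suc; _+_; _*_; _∸_; _≤_; _<_; NonZero; z≤n; s≤s; z<s)
open import Data.Nat.Properties
open import Data.Nat.DivMod using (_mod_; m%n<n; m<n⇒m%n≡m)
open import Data.Fin using (toℕ)
open import Data.Fin.Properties using (toℕ-fromℕ<)
open import Data.Maybe using (Maybe; just; nothing)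
open import Data.Maybe.Properties using (just-injective)
import Data.Product as Product
open import Data.Product using (_×_; _,_; ∃; ∃₂; Σ; proj₁; proj₂)
open import Data.Sum as Sum using (_⊎_; inj₁; inj₂)
open import Data.List using (List; []; _∷_; map)
open import Data.List.Membership.Propositional using (_∈_; _∉_)
open import Data.List.Membership.Propositional.Properties using (∈-map⁺; ∈-map⁻)
open import Data.List.Relation.Unary.Any using (here; there)
open import Data.List.Relation.Unary.All as All using (All; []; _∷_)
import Data.List.Relation.Unary.All.Properties as Allₚ
open import Data.List.Relation.Unary.AllPairs as AllPairs using (AllPairs; []; _∷_)
import Data.List.Relation.Unary.AllPairs.Properties as AllPairsₚ
open import Data.Empty using (⊥-elim)
open import Function using (_∘_; flip; case_of_)
open import Algebra.Properties.CommutativeSemigroup +-commutativeSemigroup using (x∙yz≈y∙xz)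
open import Relation.Nullary using (¬_; yes; no)
open import Relation.Binary.PropositionalEquality
  using (_≡_; _≢_; refl; sym; trans; cong; cong₂; subst; subst₂)

map≢[] : ∀ {A B : Set} {f : A → B} {xs : List A} → xs ≢ [] → map f xs ≢ []
map≢[] {xs = []}    xs≢[] _ = xs≢[] refl
map≢[] {xs = _ ∷ _} _     ()

AllPairs-map⁺-∈ : ∀ {A B : Set} {R : A → A → Set} {S : B → B → Set} {f : A → B} {xs : List A} →
  (∀ {a b} → a ∈ xs → b ∈ xs → R a b → S (f a) (f b)) → AllPairs R xs → AllPairs S (map f xs)
AllPairs-map⁺-∈ h []       = []
AllPairs-map⁺-∈ h (p ∷ ps) =
  Allₚ.map⁺ (All.tabulate λ y∈ → h (here refl) (there y∈) (All.lookup p y∈))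
  ∷ AllPairs-map⁺-∈ (λ a∈ b∈ → h (there a∈) (there b∈)) ps

IsSumMod : ℕ → ℕ → ℕ → ℕ → Set
IsSumMod n x y z = x + y ≡ z ⊎ x + y ≡ z + n

IsSumMod-comm : ∀ {n} x y {z} → IsSumMod n x y z → IsSumMod n y x z
IsSumMod-comm x y = Sum.map (trans (+-comm y x)) (trans (+-comm y x))

sum≢wrapped-sum : ∀ {n x y y′ z} → y′ < n → x + y ≡ z → x + y′ ≢ z + n
sum≢wrapped-sum {n} {x} {y} {y′} y′<n p q = <⇒≱ y′<n (subst (n ≤_) (sym y′≡y+n) (m≤n+m n y))
  where
  y′≡y+n : y′ ≡ y + n
  y′≡y+n = +-cancelˡ-≡ x _ _ (trans q (trans (cong (_+ n) (sym p)) (+-assoc x y n)))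

IsSumMod-cancelˡ : ∀ {n x y y′ z} → y < n → y′ < n →
  IsSumMod n x y z → IsSumMod n x y′ z → y ≡ y′
IsSumMod-cancelˡ {x = x} _   _    (inj₁ p) (inj₁ q) = +-cancelˡ-≡ x _ _ (trans p (sym q))
IsSumMod-cancelˡ {x = x} _   _    (inj₂ p) (inj₂ q) = +-cancelˡ-≡ x _ _ (trans p (sym q))
IsSumMod-cancelˡ         _   y′<n (inj₁ p) (inj₂ q) = ⊥-elim (sum≢wrapped-sum y′<n p q)
IsSumMod-cancelˡ         y<n _    (inj₂ p) (inj₁ q) = ⊥-elim (sum≢wrapped-sum y<n q p)

module _ {n : ℕ} .{{_ : NonZero n}} where

  toℕ-mod : ∀ {x} → x < n → toℕ (x mod n) ≡ x
  toℕ-mod {x} x<n = trans (toℕ-fromℕ< (m%n<n x n)) (m<n⇒m%n≡m x<n)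

  mod-injective : ∀ {x y} → x < n → y < n → x mod n ≡ y mod n → x ≡ y
  mod-injective x<n y<n eq = trans (sym (toℕ-mod x<n)) (trans (cong toℕ eq) (toℕ-mod y<n))

-- A cell (r, c) of a bitrade, with symbol s in the trade and s′ in its mate.
record Bicell : Set where
  constructor bicell
  field
    r c s s′ : ℕ
open Bicell

SamePosition : Bicell → Bicell → Set
SamePosition a b = r a ≡ r b × c a ≡ c b

DistinctPositions : List Bicell → Set
DistinctPositions = AllPairs (λ a b → ¬ SamePosition a b)

samePosition⇒≡ : ∀ {E a b} → DistinctPositions E → a ∈ E → b ∈ E → SamePosition a b → a ≡ b
samePosition⇒≡ (_ ∷ _)  (here refl) (here refl) _     = refl
samePosition⇒≡ (p ∷ _)  (here refl) (there b∈)  same  = ⊥-elim (All.lookup p b∈ same)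
samePosition⇒≡ (p ∷ _)  (there a∈)  (here refl) (eʳ , eᶜ) = ⊥-elim (All.lookup p a∈ (sym eʳ , sym eᶜ))
samePosition⇒≡ (_ ∷ ps) (there a∈)  (there b∈)  same  = samePosition⇒≡ ps a∈ b∈ same

record IsPartialLatin (n : ℕ) (f : Bicell → ℕ) (E : List Bicell) : Set where
  field
    bounded      : ∀ {b} → b ∈ E → r b < n × c b < n × f b < n
    distinct     : DistinctPositions E
    rowInjective : ∀ {a b} → a ∈ E → b ∈ E → r a ≡ r b → f a ≡ f b → c a ≡ c b
    colInjective : ∀ {a b} → a ∈ E → b ∈ E → c a ≡ c b → f a ≡ f b → r a ≡ r b

record IsBitrade (n : ℕ) (E : List Bicell) : Set where
  field
    mateLatin : IsPartialLatin n s′ E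
    s<n       : ∀ {b} → b ∈ E → s b < n
    isSum     : ∀ {b} → b ∈ E → IsSumMod n (r b) (c b) (s b)
    s≢s′      : ∀ {b} → b ∈ E → s b ≢ s′ b
    row-s⊆s′  : ∀ {b} → b ∈ E → ∃ λ a → a ∈ E × r a ≡ r b × s′ a ≡ s b
    row-s′⊆s  : ∀ {b} → b ∈ E → ∃ λ a → a ∈ E × r a ≡ r b × s a ≡ s′ b
    col-s⊆s′  : ∀ {b} → b ∈ E → ∃ λ a → a ∈ E × c a ≡ c b × s′ a ≡ s b
    col-s′⊆s  : ∀ {b} → b ∈ E → ∃ λ a → a ∈ E × c a ≡ c b × s a ≡ s′ b

module _ {n : ℕ} .{{_ : NonZero n}} where

  triple : (Bicell → ℕ) → Bicell → Triple n
  triple f b = r b mod n , c b mod n , f b mod n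

  module _ {f E} (L : IsPartialLatin n f E) where
    open IsPartialLatin L

    private
      same-r : ∀ {a b} → a ∈ E → b ∈ E → r a mod n ≡ r b mod n → r a ≡ r b
      same-r a∈ b∈ = mod-injective (proj₁ (bounded a∈)) (proj₁ (bounded b∈))
      same-c : ∀ {a b} → a ∈ E → b ∈ E → c a mod n ≡ c b mod n → c a ≡ c b
      same-c a∈ b∈ = mod-injective (proj₁ (proj₂ (bounded a∈))) (proj₁ (proj₂ (bounded b∈)))
      same-f : ∀ {a b} → a ∈ E → b ∈ E → f a mod n ≡ f b mod n → f a ≡ f b
      same-f a∈ b∈ = mod-injective (proj₂ (proj₂ (bounded a∈))) (proj₂ (proj₂ (bounded b∈)))

      Preimage : Triple n → Set
      Preimage t = ∃ λ b → b ∈ E × t ≡ triple f b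

      cell : ∀ {t u} → Preimage t → Preimage u → row t ≡ row u → col t ≡ col u → t ≡ u
      cell (a , a∈ , refl) (b , b∈ , refl) eʳ eᶜ
        rewrite samePosition⇒≡ distinct a∈ b∈ (same-r a∈ b∈ eʳ , same-c a∈ b∈ eᶜ) = refl

      rowSym : ∀ {t u} → Preimage t → Preimage u → row t ≡ row u → symbol t ≡ symbol u → col t ≡ col u
      rowSym (a , a∈ , refl) (b , b∈ , refl) eʳ eˢ =
        cong (_mod n) (rowInjective a∈ b∈ (same-r a∈ b∈ eʳ) (same-f a∈ b∈ eˢ))

      colSym : ∀ {t u} → Preimage t → Preimage u → col t ≡ col u → symbol t ≡ symbol u → row t ≡ row u
      colSym (a , a∈ , refl) (b , b∈ , refl) eᶜ eˢ =
        cong (_mod n) (colInjective a∈ b∈ (same-c a∈ b∈ eᶜ) (same-f a∈ b∈ eˢ))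

    isPLS : IsPLS (map (triple f) E)
    isPLS = record
      { unique = AllPairs-map⁺-∈
                   (λ a∈ b∈ apart eq → apart (same-r a∈ b∈ (cong row eq) , same-c a∈ b∈ (cong col eq)))
                   distinct
      ; cell   = λ t∈ u∈ eʳ eᶜ → cong symbol (cell (∈-map⁻ _ t∈) (∈-map⁻ _ u∈) eʳ eᶜ)
      ; rowSym = λ t∈ u∈ → rowSym (∈-map⁻ _ t∈) (∈-map⁻ _ u∈)
      ; colSym = λ t∈ u∈ → colSym (∈-map⁻ _ t∈) (∈-map⁻ _ u∈)
      }

  module _ {E} (B : IsBitrade n E) where
    open IsBitrade B
    open IsPartialLatin mateLatin using (bounded; distinct)

    private
      r<n : ∀ {b} → b ∈ E → r b < n
      r<n = proj₁ ∘ bounded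
      c<n : ∀ {b} → b ∈ E → c b < n
      c<n = proj₁ ∘ proj₂ ∘ bounded

    symbolLatin : IsPartialLatin n s E
    symbolLatin = record
      { bounded      = λ b∈ → r<n b∈ , c<n b∈ , s<n b∈
      ; distinct     = distinct
      ; rowInjective = rowInjective
      ; colInjective = colInjective
      }
      where
      rowInjective : ∀ {a b} → a ∈ E → b ∈ E → r a ≡ r b → s a ≡ s b → c a ≡ c b
      rowInjective {a} a∈ b∈ eʳ eˢ = IsSumMod-cancelˡ (c<n a∈) (c<n b∈)
        (subst₂ (λ x z → IsSumMod n x (c a) z) eʳ eˢ (isSum a∈)) (isSum b∈)

      colInjective : ∀ {a b} → a ∈ E → b ∈ E → c a ≡ c b → s a ≡ s b → r a ≡ r b
      colInjective {a} {b} a∈ b∈ eᶜ eˢ = IsSumMod-cancelˡ (r<n a∈) (r<n b∈)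
        (subst₂ (λ y z → IsSumMod n y (r a) z) eᶜ eˢ (IsSumMod-comm (r a) (c a) (isSum a∈)))
        (IsSumMod-comm (r b) (c b) (isSum b∈))

    private
      s′<n : ∀ {b} → b ∈ E → s′ b < n
      s′<n = proj₂ ∘ proj₂ ∘ bounded

      inRow : ∀ f {a x z} → a ∈ E → r a ≡ x → f a ≡ z →
              (x mod n , c a mod n , z mod n) ∈ map (triple f) E
      inRow f a∈ refl refl = ∈-map⁺ (triple f) a∈

      inCol : ∀ f {a y z} → a ∈ E → c a ≡ y → f a ≡ z →
              (r a mod n , y mod n , z mod n) ∈ map (triple f) E
      inCol f a∈ refl refl = ∈-map⁺ (triple f) a∈

      cellShared : ∀ f g {x y} →
        (∃ λ z → (x , y , z) ∈ map (triple f) E) → ∃ λ z → (x , y , z) ∈ map (triple g) E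
      cellShared f g (_ , t∈) with ∈-map⁻ (triple f) t∈
      ... | b , b∈ , refl = g b mod n , ∈-map⁺ (triple g) b∈

      rowShared : ∀ f g → (∀ {b} → b ∈ E → ∃ λ a → a ∈ E × r a ≡ r b × g a ≡ f b) →
        ∀ {x z} → (∃ λ y → (x , y , z) ∈ map (triple f) E) → ∃ λ y → (x , y , z) ∈ map (triple g) E
      rowShared f g cover (_ , t∈) with ∈-map⁻ (triple f) t∈
      ... | b , b∈ , refl with cover b∈
      ...   | a , a∈ , eʳ , eˢ = c a mod n , inRow g a∈ eʳ eˢ

      colShared : ∀ f g → (∀ {b} → b ∈ E → ∃ λ a → a ∈ E × c a ≡ c b × g a ≡ f b) →
        ∀ {y z} → (∃ λ x → (x , y , z) ∈ map (triple f) E) → ∃ λ x → (x , y , z) ∈ map (triple g) E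
      colShared f g cover (_ , t∈) with ∈-map⁻ (triple f) t∈
      ... | b , b∈ , refl with cover b∈
      ...   | a , a∈ , eᶜ , eˢ = r a mod n , inCol g a∈ eᶜ eˢ

      inB : ∀ {t} → t ∈ map (triple s) E → InB n t
      inB t∈ with ∈-map⁻ (triple s) t∈
      ... | b , b∈ , refl rewrite toℕ-mod (r<n b∈) | toℕ-mod (c<n b∈) | toℕ-mod (s<n b∈) = isSum b∈

      disjoint : ∀ {t} → t ∈ map (triple s) E → t ∉ map (triple s′) E
      disjoint t∈ t∈′ with ∈-map⁻ (triple s) t∈ | ∈-map⁻ (triple s′) t∈′
      ... | a , a∈ , refl | b , b∈ , eq
        with samePosition⇒≡ distinct a∈ b∈
               (mod-injective (r<n a∈) (r<n b∈) (cong row eq) , mod-injective (c<n a∈) (c<n b∈) (cong col eq))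
      ... | refl = s≢s′ a∈ (mod-injective (s<n a∈) (s′<n a∈) (cong symbol eq))

    isLatinTrade : E ≢ [] → IsLatinTradeInB n (map (triple s) E)
    isLatinTrade E≢[] = record
      { nonEmpty = map≢[] E≢[]
      ; inB      = inB
      ; pls      = isPLS symbolLatin
      ; mate     = map (triple s′) E
      ; matePLS  = isPLS mateLatin
      ; disjoint = disjoint
      ; cells    = λ _ _ → cellShared s s′
      ; cells'   = λ _ _ → cellShared s′ s
      ; rows     = λ _ _ → rowShared s s′ row-s⊆s′
      ; rows'    = λ _ _ → rowShared s′ s row-s′⊆s
      ; cols     = λ _ _ → colShared s s′ col-s⊆s′
      ; cols'    = λ _ _ → colShared s′ s col-s′⊆s
      }

    hasCell : ∀ {b} → b ∈ E → HasCell (map (triple s) E) (r b) (c b)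
    hasCell {b} b∈ = triple s b , ∈-map⁺ (triple s) b∈ , toℕ-mod (r<n b∈) , toℕ-mod (c<n b∈)

    ∈-triples⁻ : ∀ {t} → t ∈ map (triple s) E →
                 ∃ λ b → b ∈ E × toℕ (row t) ≡ r b × toℕ (col t) ≡ c b
    ∈-triples⁻ t∈ with ∈-map⁻ (triple s) t∈
    ... | b , b∈ , refl = b , b∈ , toℕ-mod (r<n b∈) , toℕ-mod (c<n b∈)

≤⇒≢+suc : ∀ {a b c} → a ≤ b → a ≢ b + suc c
≤⇒≢+suc {b = b} a≤b = <⇒≢ (≤-<-trans a≤b (m<m+n b z<s))

-- A cell (i, j) of the addition table of ℕ, holding i + j, with its mate symbol; nothing is ⋆.
record Slot : Set where
  constructor slot
  field
    i j  : ℕ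
    mate : Maybe ℕ
open Slot

record IsDefectTrade (k l : ℕ) (D : List Slot) : Set where
  field
    bounded           : ∀ {e} → e ∈ D → i e ≤ k × j e ≤ l
    distinct          : AllPairs (λ a b → ¬ (i a ≡ i b × j a ≡ j b)) D
    mate≢sum          : ∀ {e} → e ∈ D → mate e ≢ just (i e + j e)
    mate≢0            : ∀ {e} → e ∈ D → mate e ≢ just 0
    mate≤             : ∀ {e v} → e ∈ D → mate e ≡ just v → v ≤ k + l
    top-position      : ∀ {e} → e ∈ D → mate e ≡ just (k + l) → i e ≡ k × j e ≡ 0
    ⋆-position        : ∀ {e} → e ∈ D → mate e ≡ nothing → i e ≡ 0 × j e ≡ l
    mate-rowInjective : ∀ {a b} → a ∈ D → b ∈ D → i a ≡ i b → mate a ≡ mate b → j a ≡ j b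
    mate-colInjective : ∀ {a b} → a ∈ D → b ∈ D → j a ≡ j b → mate a ≡ mate b → i a ≡ i b
    row-sum⊆mate      : ∀ {e} → e ∈ D → (i e ≡ 0 × j e ≡ 0)
                        ⊎ ∃ λ e′ → e′ ∈ D × i e′ ≡ i e × mate e′ ≡ just (i e + j e)
    row-mate⊆sum      : ∀ {e} → e ∈ D → mate e ≡ nothing
                        ⊎ ∃ λ e′ → e′ ∈ D × i e′ ≡ i e × mate e ≡ just (i e′ + j e′)
    col-sum⊆mate      : ∀ {e} → e ∈ D → (i e ≡ 0 × j e ≡ 0) ⊎ (i e ≡ k × j e ≡ l)
                        ⊎ ∃ λ e′ → e′ ∈ D × j e′ ≡ j e × mate e′ ≡ just (i e + j e)
    col-mate⊆sum      : ∀ {e} → e ∈ D → mate e ≡ just (k + l) ⊎ mate e ≡ nothing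
                        ⊎ ∃ λ e′ → e′ ∈ D × j e′ ≡ j e × mate e ≡ just (i e′ + j e′)
    corner₀₀          : ∃ λ t → slot 0 0 t ∈ D
    corner₀ₗ          : slot 0 l nothing ∈ D
    cornerₖ₀          : slot k 0 (just (k + l)) ∈ D
    cornerₖₗ          : ∃ λ t → slot k l t ∈ D

column₀ : ℕ → List Slot
column₀ l = slot 0 0 (just l) ∷ slot 0 l nothing ∷ []

column₀-isDefectTrade : ∀ l₀ → IsDefectTrade 0 (suc l₀) (column₀ (suc l₀))
column₀-isDefectTrade l₀ = record
  { bounded           = λ { (here refl) → z≤n , z≤n ; (there (here refl)) → z≤n , ≤-refl }
  ; distinct          = ((λ { (_ , ()) }) ∷ []) ∷ [] ∷ []
  ; mate≢sum          = λ { (here refl) () ; (there (here refl)) () }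
  ; mate≢0            = λ { (here refl) () ; (there (here refl)) () }
  ; mate≤             = λ { (here refl) refl → ≤-refl ; (there (here refl)) () }
  ; top-position      = λ { (here refl) _ → refl , refl ; (there (here refl)) () }
  ; ⋆-position        = λ { (here refl) () ; (there (here refl)) _ → refl , refl }
  ; mate-rowInjective = rowInjective
  ; mate-colInjective = colInjective
  ; row-sum⊆mate      = λ { (here refl) → inj₁ (refl , refl)
                          ; (there (here refl)) → inj₂ (_ , here refl , refl , refl) }
  ; row-mate⊆sum      = λ { (here refl) → inj₂ (_ , there (here refl) , refl , refl)
                          ; (there (here refl)) → inj₁ refl }
  ; col-sum⊆mate      = λ { (here refl) → inj₁ (refl , refl)
                          ; (there (here refl)) → inj₂ (inj₁ (refl , refl)) }
  ; col-mate⊆sum      = λ { (here refl) → inj₁ refl ; (there (here refl)) → inj₂ (inj₁ refl) }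
  ; corner₀₀          = _ , here refl
  ; corner₀ₗ          = there (here refl)
  ; cornerₖ₀          = here refl
  ; cornerₖₗ          = _ , there (here refl)
  }
  where
  D = column₀ (suc l₀)
  rowInjective : ∀ {a b} → a ∈ D → b ∈ D → i a ≡ i b → mate a ≡ mate b → j a ≡ j b
  rowInjective (here refl)         (here refl)         _ _  = refl
  rowInjective (there (here refl)) (there (here refl)) _ _  = refl
  rowInjective (here refl)         (there (here refl)) _ ()
  rowInjective (there (here refl)) (here refl)         _ ()
  colInjective : ∀ {a b} → a ∈ D → b ∈ D → j a ≡ j b → mate a ≡ mate b → i a ≡ i b
  colInjective (here refl)         (here refl)         _ _ = refl
  colInjective (there (here refl)) (there (here refl)) _ _ = refl
  colInjective (here refl)         (there (here refl)) () _
  colInjective (there (here refl)) (here refl)         () _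

growRows : ℕ → ℕ → List Slot → List Slot
growRows k l D = slot k 0 (just (k + l)) ∷ slot k l (just k) ∷ D

module GrowRows {k′ l₀ : ℕ} {D : List Slot} (T : IsDefectTrade k′ (suc l₀) D) where
  private
    module T = IsDefectTrade T
    l = suc l₀
    k = k′ + l
    N = growRows k l D

    just-k≡k+0 : just k ≡ just (k + 0)
    just-k≡k+0 = cong just (sym (+-identityʳ k))

    k≢k+l : k ≢ k + l
    k≢k+l = ≤⇒≢+suc ≤-refl

    oldRow≢k : ∀ {e} → e ∈ D → k ≢ i e
    oldRow≢k e∈ = ≤⇒≢+suc (proj₁ (T.bounded e∈)) ∘ sym

    oldMate≢top : ∀ {e v} → e ∈ D → mate e ≡ just v → v ≢ k + l
    oldMate≢top e∈ p = ≤⇒≢+suc (T.mate≤ e∈ p)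

    oldTop⇒col≡0 : ∀ {e} → e ∈ D → mate e ≡ just k → j e ≡ 0
    oldTop⇒col≡0 e∈ = proj₂ ∘ T.top-position e∈

    old : ∀ {P : Slot → Set} → (∃ λ e′ → e′ ∈ D × P e′) → ∃ λ e′ → e′ ∈ N × P e′
    old (e′ , e′∈ , p) = e′ , there (there e′∈) , p

    bounded : ∀ {e} → e ∈ N → i e ≤ k × j e ≤ l
    bounded (here refl)         = ≤-refl , z≤n
    bounded (there (here refl)) = ≤-refl , ≤-refl
    bounded (there (there e∈))  = ≤-trans (proj₁ (T.bounded e∈)) (m≤m+n k′ l) , proj₂ (T.bounded e∈)

    mate≢sum : ∀ {e} → e ∈ N → mate e ≢ just (i e + j e)
    mate≢sum (here refl)         = (λ ()) ∘ +-cancelˡ-≡ k l 0 ∘ just-injective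
    mate≢sum (there (here refl)) = k≢k+l ∘ just-injective
    mate≢sum (there (there e∈))  = T.mate≢sum e∈

    mate≢0 : ∀ {e} → e ∈ N → mate e ≢ just 0
    mate≢0 (here refl)         = m+1+n≢0 k ∘ just-injective
    mate≢0 (there (here refl)) = m+1+n≢0 k′ ∘ just-injective
    mate≢0 (there (there e∈))  = T.mate≢0 e∈

    mate≤ : ∀ {e v} → e ∈ N → mate e ≡ just v → v ≤ k + l
    mate≤ (here refl)         refl = ≤-refl
    mate≤ (there (here refl)) refl = m≤m+n k l
    mate≤ (there (there e∈))  p    = ≤-trans (T.mate≤ e∈ p) (m≤m+n k l)

    top-position : ∀ {e} → e ∈ N → mate e ≡ just (k + l) → i e ≡ k × j e ≡ 0
    top-position (here refl)         _ = refl , refl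
    top-position (there (here refl)) p = ⊥-elim (k≢k+l (just-injective p))
    top-position (there (there e∈))  p = ⊥-elim (oldMate≢top e∈ p refl)

    ⋆-position : ∀ {e} → e ∈ N → mate e ≡ nothing → i e ≡ 0 × j e ≡ l
    ⋆-position (here refl)         ()
    ⋆-position (there (here refl)) ()
    ⋆-position (there (there e∈))  = T.⋆-position e∈

    mate-rowInjective : ∀ {a b} → a ∈ N → b ∈ N → i a ≡ i b → mate a ≡ mate b → j a ≡ j b
    mate-rowInjective (here refl)         (here refl)         _ _ = refl
    mate-rowInjective (here refl)         (there (here refl)) _ p = ⊥-elim (k≢k+l (just-injective (sym p)))
    mate-rowInjective (there (here refl)) (here refl)         _ p = ⊥-elim (k≢k+l (just-injective p))
    mate-rowInjective (there (here refl)) (there (here refl)) _ _ = refl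
    mate-rowInjective (here refl)         (there (there b∈))  q _ = ⊥-elim (oldRow≢k b∈ q)
    mate-rowInjective (there (here refl)) (there (there b∈))  q _ = ⊥-elim (oldRow≢k b∈ q)
    mate-rowInjective (there (there a∈))  (here refl)         q _ = ⊥-elim (oldRow≢k a∈ (sym q))
    mate-rowInjective (there (there a∈))  (there (here refl)) q _ = ⊥-elim (oldRow≢k a∈ (sym q))
    mate-rowInjective (there (there a∈))  (there (there b∈))  q p = T.mate-rowInjective a∈ b∈ q p

    mate-colInjective : ∀ {a b} → a ∈ N → b ∈ N → j a ≡ j b → mate a ≡ mate b → i a ≡ i b
    mate-colInjective (here refl)         (here refl)         _  _ = refl
    mate-colInjective (there (here refl)) (there (here refl)) _  _ = refl
    mate-colInjective (here refl)         (there (here refl)) () _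
    mate-colInjective (there (here refl)) (here refl)         () _
    mate-colInjective (here refl)         (there (there b∈))  _  p = ⊥-elim (oldMate≢top b∈ (sym p) refl)
    mate-colInjective (there (there a∈))  (here refl)         _  p = ⊥-elim (oldMate≢top a∈ p refl)
    mate-colInjective (there (here refl)) (there (there b∈))  q  p with () ← trans q (oldTop⇒col≡0 b∈ (sym p))
    mate-colInjective (there (there a∈))  (there (here refl)) q  p with () ← trans (sym q) (oldTop⇒col≡0 a∈ p)
    mate-colInjective (there (there a∈))  (there (there b∈))  q  p = T.mate-colInjective a∈ b∈ q p

    row-sum⊆mate : ∀ {e} → e ∈ N → (i e ≡ 0 × j e ≡ 0)
                   ⊎ ∃ λ e′ → e′ ∈ N × i e′ ≡ i e × mate e′ ≡ just (i e + j e)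
    row-sum⊆mate (here refl)         = inj₂ (_ , there (here refl) , refl , just-k≡k+0)
    row-sum⊆mate (there (here refl)) = inj₂ (_ , here refl , refl , refl)
    row-sum⊆mate (there (there e∈))  = Sum.map₂ old (T.row-sum⊆mate e∈)

    row-mate⊆sum : ∀ {e} → e ∈ N → mate e ≡ nothing
                   ⊎ ∃ λ e′ → e′ ∈ N × i e′ ≡ i e × mate e ≡ just (i e′ + j e′)
    row-mate⊆sum (here refl)         = inj₂ (_ , there (here refl) , refl , refl)
    row-mate⊆sum (there (here refl)) = inj₂ (_ , here refl , refl , just-k≡k+0)
    row-mate⊆sum (there (there e∈))  = Sum.map₂ old (T.row-mate⊆sum e∈)

    col-sum⊆mate : ∀ {e} → e ∈ N → (i e ≡ 0 × j e ≡ 0) ⊎ (i e ≡ k × j e ≡ l)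
                   ⊎ ∃ λ e′ → e′ ∈ N × j e′ ≡ j e × mate e′ ≡ just (i e + j e)
    col-sum⊆mate (here refl)         = inj₂ (inj₂ (_ , there (there T.cornerₖ₀) , refl , just-k≡k+0))
    col-sum⊆mate (there (here refl)) = inj₂ (inj₁ (refl , refl))
    col-sum⊆mate (there (there e∈)) with T.col-sum⊆mate e∈
    ... | inj₁ origin           = inj₁ origin
    ... | inj₂ (inj₁ (p , q))   = inj₂ (inj₂ (_ , there (here refl) , sym q , cong just (sym (cong₂ _+_ p q))))
    ... | inj₂ (inj₂ witness)   = inj₂ (inj₂ (old witness))

    col-mate⊆sum : ∀ {e} → e ∈ N → mate e ≡ just (k + l) ⊎ mate e ≡ nothing
                   ⊎ ∃ λ e′ → e′ ∈ N × j e′ ≡ j e × mate e ≡ just (i e′ + j e′)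
    col-mate⊆sum (here refl)         = inj₁ refl
    col-mate⊆sum (there (here refl)) = inj₂ (inj₂ (_ , there (there (proj₂ T.cornerₖₗ)) , refl , refl))
    col-mate⊆sum (there (there e∈)) with T.col-mate⊆sum e∈
    ... | inj₁ p               = inj₂ (inj₂ (_ , here refl , sym (oldTop⇒col≡0 e∈ p) , trans p just-k≡k+0))
    ... | inj₂ (inj₁ p)        = inj₂ (inj₁ p)
    ... | inj₂ (inj₂ witness)  = inj₂ (inj₂ (old witness))

  isDefectTrade : IsDefectTrade k l N
  isDefectTrade = record
    { bounded           = bounded
    ; distinct          = ((λ { (_ , ()) }) ∷ All.tabulate (λ e∈ → oldRow≢k e∈ ∘ proj₁))
                          ∷ All.tabulate (λ e∈ → oldRow≢k e∈ ∘ proj₁)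
                          ∷ T.distinct
    ; mate≢sum          = mate≢sum
    ; mate≢0            = mate≢0
    ; mate≤             = mate≤
    ; top-position      = top-position
    ; ⋆-position        = ⋆-position
    ; mate-rowInjective = mate-rowInjective
    ; mate-colInjective = mate-colInjective
    ; row-sum⊆mate      = row-sum⊆mate
    ; row-mate⊆sum      = row-mate⊆sum
    ; col-sum⊆mate      = col-sum⊆mate
    ; col-mate⊆sum      = col-mate⊆sum
    ; corner₀₀          = Product.map₂ (there ∘ there) T.corner₀₀
    ; corner₀ₗ          = there (there T.corner₀ₗ)
    ; cornerₖ₀          = here refl
    ; cornerₖₗ          = _ , there (here refl)
    }

sum-at-bound : ∀ {x y a b} → x ≤ a → y ≤ b → x + y ≡ a + b → x ≡ a × y ≡ b
sum-at-bound {x} {y} {a} {b} x≤a y≤b eq = x≡a , +-cancelˡ-≡ a y b (trans (cong (_+ y) (sym x≡a)) eq)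
  where
  x≡a : x ≡ a
  x≡a = ≤-antisym x≤a (+-cancelʳ-≤ b a x (≤-trans (≤-reflexive (sym eq)) (+-monoʳ-≤ x y≤b)))

relabel : ℕ → ℕ → Maybe ℕ → Maybe ℕ
relabel t t′ nothing  = just t
relabel t t′ (just v) with v ≟ t
... | yes _ = just t′
... | no  _ = just v

relabel-top : ∀ t t′ → relabel t t′ (just t) ≡ just t′
relabel-top t t′ with t ≟ t
... | yes _   = refl
... | no t≢t = ⊥-elim (t≢t refl)

relabel-other : ∀ {t t′ v} → v ≢ t → relabel t t′ (just v) ≡ just v
relabel-other {t} {t′} {v} v≢t with v ≟ t
... | yes v≡t = ⊥-elim (v≢t v≡t)
... | no  _   = refl

relabel≢nothing : ∀ t t′ a → relabel t t′ a ≢ nothing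
relabel≢nothing t t′ nothing  ()
relabel≢nothing t t′ (just v) with v ≟ t
... | yes _ = λ ()
... | no  _ = λ ()

relabel-injective : ∀ {t t′ a b} →
  (∀ {v} → a ≡ just v → v < t′) → (∀ {v} → b ≡ just v → v < t′) →
  relabel t t′ a ≡ relabel t t′ b → a ≡ b
relabel-injective {a = nothing} {nothing} _ _ _ = refl
relabel-injective {t} {a = nothing} {just w} _ w<t′ eq with w ≟ t
... | yes refl = ⊥-elim (<⇒≢ (w<t′ refl) (just-injective eq))
... | no  w≢t  = ⊥-elim (w≢t (sym (just-injective eq)))
relabel-injective {a = just v} {nothing} v<t′ _ eq = sym (relabel-injective (λ ()) v<t′ (sym eq))
relabel-injective {t} {a = just v} {just w} v<t′ w<t′ eq with v ≟ t | w ≟ t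
... | yes refl | yes refl = refl
... | yes refl | no  _    = ⊥-elim (<⇒≢ (w<t′ refl) (sym (just-injective eq)))
... | no  _    | yes refl = ⊥-elim (<⇒≢ (v<t′ refl) (just-injective eq))
... | no  _    | no  _    = eq

relabelSlot : ℕ → ℕ → Slot → Slot
relabelSlot t t′ e = slot (i e) (j e) (relabel t t′ (mate e))

growColumns : ℕ → ℕ → List Slot → List Slot
growColumns k l D = slot 0 l nothing ∷ slot k l (just l) ∷ map (relabelSlot l (k + l)) D

module GrowColumns {k₀ l′ : ℕ} {D : List Slot} (T : IsDefectTrade (suc k₀) l′ D) where
  private
    module T = IsDefectTrade T
    k = suc k₀
    l = k + l′
    σ = relabel l (k + l)
    N = growColumns k l D

    data Member : Slot → Set where
      new⋆   : Member (slot 0 l nothing)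
      newₖₗ  : Member (slot k l (just l))
      old    : ∀ {x y t} → slot x y t ∈ D → Member (slot x y (σ t))

    member : ∀ {e} → e ∈ N → Member e
    member (here refl)         = new⋆
    member (there (here refl)) = newₖₗ
    member (there (there e∈)) with ∈-map⁻ (relabelSlot l (k + l)) e∈
    ... | _ , e₀∈ , refl = old e₀∈

    ∈new⋆ : slot 0 l nothing ∈ N
    ∈new⋆ = here refl
    ∈newₖₗ : slot k l (just l) ∈ N
    ∈newₖₗ = there (here refl)
    ∈old : ∀ {x y t} → slot x y t ∈ D → slot x y (σ t) ∈ N
    ∈old e∈ = there (there (∈-map⁺ (relabelSlot l (k + l)) e∈))

    l<k+l : l < k + l
    l<k+l = m<n+m l z<s

    oldMate<k+l : ∀ {x y t v} → slot x y t ∈ D → t ≡ just v → v < k + l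
    oldMate<k+l e∈ p = ≤-<-trans (T.mate≤ e∈ p) l<k+l

    oldSum≤l : ∀ {x y t} → slot x y t ∈ D → x + y ≤ l
    oldSum≤l e∈ = +-mono-≤ (proj₁ (T.bounded e∈)) (proj₂ (T.bounded e∈))

    oldCol≢l : ∀ {x y t} → slot x y t ∈ D → y ≢ l
    oldCol≢l e∈ = ≤⇒≢+suc (proj₂ (T.bounded e∈)) ∘ flip trans (+-comm k l′)

    sum≡l⇒corner : ∀ {x y t} → slot x y t ∈ D → x + y ≡ l → x ≡ k × y ≡ l′
    sum≡l⇒corner e∈ = sum-at-bound (proj₁ (T.bounded e∈)) (proj₂ (T.bounded e∈))

    σ≡l⇒row≡0 : ∀ {x y t} → slot x y t ∈ D → σ t ≡ just l → x ≡ 0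
    σ≡l⇒row≡0 e∈ eq = proj₁ (T.⋆-position e∈ (relabel-injective (oldMate<k+l e∈) (λ ()) eq))

    σ-mate≢sum : ∀ {x y t} → slot x y t ∈ D → σ t ≢ just (x + y)
    σ-mate≢sum {t = nothing} e∈ eq with refl , refl ← T.⋆-position e∈ refl =
      m≢1+n+m l′ (sym (just-injective eq))
    σ-mate≢sum {t = just v}  e∈ eq with v ≟ l
    ... | yes refl = <⇒≢ (≤-<-trans (oldSum≤l e∈) l<k+l) (sym (just-injective eq))
    ... | no  _    = T.mate≢sum e∈ eq

    σ-mate≢0 : ∀ {x y t} → slot x y t ∈ D → σ t ≢ just 0
    σ-mate≢0 {t = nothing} _  ()
    σ-mate≢0 {t = just v}  e∈ with v ≟ l
    ... | yes _ = λ ()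
    ... | no  _ = T.mate≢0 e∈

    σ-mate≤ : ∀ {x y t w} → slot x y t ∈ D → σ t ≡ just w → w ≤ k + l
    σ-mate≤ {t = nothing} _  refl = <⇒≤ l<k+l
    σ-mate≤ {t = just v}  e∈ eq with v ≟ l | eq
    ... | yes _ | refl = ≤-refl
    ... | no  _ | refl = <⇒≤ (oldMate<k+l e∈ refl)

    σ-top-position : ∀ {x y t} → slot x y t ∈ D → σ t ≡ just (k + l) → x ≡ k × y ≡ 0
    σ-top-position {t = nothing} _  eq = ⊥-elim (<⇒≢ l<k+l (just-injective eq))
    σ-top-position {t = just v}  e∈ eq with v ≟ l
    ... | yes refl = T.top-position e∈ refl
    ... | no  _    = ⊥-elim (<⇒≢ (oldMate<k+l e∈ refl) (just-injective eq))

    σ-row-sum⊆mate : ∀ {x y t} → slot x y t ∈ D → (x ≡ 0 × y ≡ 0)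
                     ⊎ ∃ λ e′ → e′ ∈ N × i e′ ≡ x × mate e′ ≡ just (x + y)
    σ-row-sum⊆mate {x} {y} e∈ with T.row-sum⊆mate e∈
    ... | inj₁ origin = inj₁ origin
    ... | inj₂ (e′ , e′∈ , p , q) with x + y ≟ l
    ...   | yes s≡l = inj₂ (_ , ∈newₖₗ , sym (proj₁ (sum≡l⇒corner e∈ s≡l)) , cong just (sym s≡l))
    ...   | no  s≢l = inj₂ (_ , ∈old e′∈ , p , trans (cong σ q) (relabel-other s≢l))

    σ-row-mate⊆sum : ∀ {x y t} → slot x y t ∈ D → σ t ≡ nothing
                     ⊎ ∃ λ e′ → e′ ∈ N × i e′ ≡ x × σ t ≡ just (i e′ + j e′)
    σ-row-mate⊆sum {t = nothing} e∈ with refl , refl ← T.⋆-position e∈ refl =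
      inj₂ (_ , ∈new⋆ , refl , refl)
    σ-row-mate⊆sum {t = just v}  e∈ with v ≟ l
    ... | yes refl with refl , refl ← T.top-position e∈ refl = inj₂ (_ , ∈newₖₗ , refl , refl)
    ... | no  _ with T.row-mate⊆sum e∈
    ...   | inj₂ (e′ , e′∈ , p , q) = inj₂ (_ , ∈old e′∈ , p , q)

    σ-col-sum⊆mate : ∀ {x y t} → slot x y t ∈ D → (x ≡ 0 × y ≡ 0) ⊎ (x ≡ k × y ≡ l)
                     ⊎ ∃ λ e′ → e′ ∈ N × j e′ ≡ y × mate e′ ≡ just (x + y)
    σ-col-sum⊆mate {x} {y} e∈ with T.col-sum⊆mate e∈
    ... | inj₁ origin               = inj₁ origin
    ... | inj₂ (inj₁ (refl , refl)) = inj₂ (inj₂ (_ , ∈old T.corner₀ₗ , refl , refl))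
    ... | inj₂ (inj₂ (e′ , e′∈ , p , q)) with x + y ≟ l
    ...   | yes s≡l with refl , refl ← sum≡l⇒corner e∈ s≡l =
      inj₂ (inj₂ (_ , ∈old T.corner₀ₗ , refl , refl))
    ...   | no  s≢l = inj₂ (inj₂ (_ , ∈old e′∈ , p , trans (cong σ q) (relabel-other s≢l)))

    σ-col-mate⊆sum : ∀ {x y t} → slot x y t ∈ D → σ t ≡ just (k + l) ⊎ σ t ≡ nothing
                     ⊎ ∃ λ e′ → e′ ∈ N × j e′ ≡ y × σ t ≡ just (i e′ + j e′)
    σ-col-mate⊆sum {t = nothing} e∈ with refl , refl ← T.⋆-position e∈ refl =
      inj₂ (inj₂ (_ , ∈old (proj₂ T.cornerₖₗ) , refl , refl))
    σ-col-mate⊆sum {t = just v}  e∈ with v ≟ l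
    ... | yes refl = inj₁ refl
    ... | no  v≢l with T.col-mate⊆sum e∈
    ...   | inj₁ p                         = ⊥-elim (v≢l (just-injective p))
    ...   | inj₂ (inj₂ (e′ , e′∈ , p , q)) = inj₂ (inj₂ (_ , ∈old e′∈ , p , q))

    bounded : ∀ {e} → e ∈ N → i e ≤ k × j e ≤ l
    bounded e∈ with member e∈
    ... | new⋆    = z≤n , ≤-refl
    ... | newₖₗ   = ≤-refl , ≤-refl
    ... | old e₀∈ = proj₁ (T.bounded e₀∈) , ≤-trans (proj₂ (T.bounded e₀∈)) (m≤n+m l′ k)

    mate≢sum : ∀ {e} → e ∈ N → mate e ≢ just (i e + j e)
    mate≢sum e∈ with member e∈
    ... | new⋆    = λ ()
    ... | newₖₗ   = <⇒≢ l<k+l ∘ just-injective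
    ... | old e₀∈ = σ-mate≢sum e₀∈

    mate≢0 : ∀ {e} → e ∈ N → mate e ≢ just 0
    mate≢0 e∈ with member e∈
    ... | new⋆    = λ ()
    ... | newₖₗ   = λ ()
    ... | old e₀∈ = σ-mate≢0 e₀∈

    mate≤ : ∀ {e v} → e ∈ N → mate e ≡ just v → v ≤ k + l
    mate≤ e∈ with member e∈
    ... | new⋆    = λ ()
    ... | newₖₗ   = λ { refl → <⇒≤ l<k+l }
    ... | old e₀∈ = σ-mate≤ e₀∈

    top-position : ∀ {e} → e ∈ N → mate e ≡ just (k + l) → i e ≡ k × j e ≡ 0
    top-position e∈ with member e∈
    ... | new⋆    = λ ()
    ... | newₖₗ   = ⊥-elim ∘ <⇒≢ l<k+l ∘ just-injective
    ... | old e₀∈ = σ-top-position e₀∈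

    ⋆-position : ∀ {e} → e ∈ N → mate e ≡ nothing → i e ≡ 0 × j e ≡ l
    ⋆-position e∈ with member e∈
    ... | new⋆             = λ _ → refl , refl
    ... | newₖₗ            = λ ()
    ... | old {t = t} e₀∈  = ⊥-elim ∘ relabel≢nothing l (k + l) t

    mate-rowInjective : ∀ {a b} → a ∈ N → b ∈ N → i a ≡ i b → mate a ≡ mate b → j a ≡ j b
    mate-rowInjective a∈ b∈ q p with member a∈ | member b∈
    ... | new⋆    | new⋆    = refl
    ... | newₖₗ   | newₖₗ   = refl
    ... | new⋆    | newₖₗ   = ⊥-elim (0≢1+n q)
    ... | newₖₗ   | new⋆    = ⊥-elim (0≢1+n (sym q))
    ... | new⋆    | old {t = t} _ = ⊥-elim (relabel≢nothing l (k + l) t (sym p))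
    ... | old {t = t} _ | new⋆  = ⊥-elim (relabel≢nothing l (k + l) t p)
    ... | newₖₗ   | old b₀∈ = ⊥-elim (0≢1+n (trans (sym (σ≡l⇒row≡0 b₀∈ (sym p))) (sym q)))
    ... | old a₀∈ | newₖₗ   = ⊥-elim (0≢1+n (trans (sym (σ≡l⇒row≡0 a₀∈ p)) q))
    ... | old a₀∈ | old b₀∈ =
      T.mate-rowInjective a₀∈ b₀∈ q (relabel-injective (oldMate<k+l a₀∈) (oldMate<k+l b₀∈) p)

    mate-colInjective : ∀ {a b} → a ∈ N → b ∈ N → j a ≡ j b → mate a ≡ mate b → i a ≡ i b
    mate-colInjective a∈ b∈ q p with member a∈ | member b∈
    ... | new⋆    | new⋆    = refl
    ... | newₖₗ   | newₖₗ   = refl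
    ... | new⋆    | newₖₗ   = case p of λ ()
    ... | newₖₗ   | new⋆    = case p of λ ()
    ... | new⋆    | old b₀∈ = ⊥-elim (oldCol≢l b₀∈ (sym q))
    ... | newₖₗ   | old b₀∈ = ⊥-elim (oldCol≢l b₀∈ (sym q))
    ... | old a₀∈ | new⋆    = ⊥-elim (oldCol≢l a₀∈ q)
    ... | old a₀∈ | newₖₗ   = ⊥-elim (oldCol≢l a₀∈ q)
    ... | old a₀∈ | old b₀∈ =
      T.mate-colInjective a₀∈ b₀∈ q (relabel-injective (oldMate<k+l a₀∈) (oldMate<k+l b₀∈) p)

    row-sum⊆mate : ∀ {e} → e ∈ N → (i e ≡ 0 × j e ≡ 0)
                   ⊎ ∃ λ e′ → e′ ∈ N × i e′ ≡ i e × mate e′ ≡ just (i e + j e)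
    row-sum⊆mate e∈ with member e∈
    ... | new⋆    = inj₂ (_ , ∈old T.corner₀ₗ , refl , refl)
    ... | newₖₗ   = inj₂ (_ , ∈old T.cornerₖ₀ , refl , relabel-top l (k + l))
    ... | old e₀∈ = σ-row-sum⊆mate e₀∈

    row-mate⊆sum : ∀ {e} → e ∈ N → mate e ≡ nothing
                   ⊎ ∃ λ e′ → e′ ∈ N × i e′ ≡ i e × mate e ≡ just (i e′ + j e′)
    row-mate⊆sum e∈ with member e∈
    ... | new⋆    = inj₁ refl
    ... | newₖₗ   = inj₂ (_ , ∈old (proj₂ T.cornerₖₗ) , refl , refl)
    ... | old e₀∈ = σ-row-mate⊆sum e₀∈

    col-sum⊆mate : ∀ {e} → e ∈ N → (i e ≡ 0 × j e ≡ 0) ⊎ (i e ≡ k × j e ≡ l)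
                   ⊎ ∃ λ e′ → e′ ∈ N × j e′ ≡ j e × mate e′ ≡ just (i e + j e)
    col-sum⊆mate e∈ with member e∈
    ... | new⋆    = inj₂ (inj₂ (_ , ∈newₖₗ , refl , refl))
    ... | newₖₗ   = inj₂ (inj₁ (refl , refl))
    ... | old e₀∈ = σ-col-sum⊆mate e₀∈

    col-mate⊆sum : ∀ {e} → e ∈ N → mate e ≡ just (k + l) ⊎ mate e ≡ nothing
                   ⊎ ∃ λ e′ → e′ ∈ N × j e′ ≡ j e × mate e ≡ just (i e′ + j e′)
    col-mate⊆sum e∈ with member e∈
    ... | new⋆    = inj₂ (inj₁ refl)
    ... | newₖₗ   = inj₂ (inj₂ (_ , ∈new⋆ , refl , refl))
    ... | old e₀∈ = σ-col-mate⊆sum e₀∈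

  isDefectTrade : IsDefectTrade k l N
  isDefectTrade = record
    { bounded           = bounded
    ; distinct          = ((λ { (() , _) }) ∷ oldColumns) ∷ oldColumns ∷ AllPairsₚ.map⁺ T.distinct
    ; mate≢sum          = mate≢sum
    ; mate≢0            = mate≢0
    ; mate≤             = mate≤
    ; top-position      = top-position
    ; ⋆-position        = ⋆-position
    ; mate-rowInjective = mate-rowInjective
    ; mate-colInjective = mate-colInjective
    ; row-sum⊆mate      = row-sum⊆mate
    ; row-mate⊆sum      = row-mate⊆sum
    ; col-sum⊆mate      = col-sum⊆mate
    ; col-mate⊆sum      = col-mate⊆sum
    ; corner₀₀          = Product.map σ ∈old T.corner₀₀
    ; corner₀ₗ          = ∈new⋆
    ; cornerₖ₀          = subst (λ t → slot k 0 t ∈ N) (relabel-top l (k + l)) (∈old T.cornerₖ₀)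
    ; cornerₖₗ          = _ , ∈newₖₗ
    }
    where
    oldColumns : ∀ {x} → All (λ e → ¬ (x ≡ i e × l ≡ j e)) (map (relabelSlot l (k + l)) D)
    oldColumns = Allₚ.map⁺ (All.tabulate (λ e∈ → oldCol≢l e∈ ∘ sym ∘ proj₂))

data Euclid : ℕ → ℕ → Set where
  start    : ∀ l₀ → Euclid 0 (suc l₀)
  addRows  : ∀ {k l₀} → Euclid k (suc l₀) → Euclid (k + suc l₀) (suc l₀)
  addCols  : ∀ {k₀ l} → Euclid (suc k₀) l → Euclid (suc k₀) (suc k₀ + l)

euclid : ∀ k l₀ → Euclid k (suc l₀)
euclid k l₀ = go (suc (k + l₀)) k l₀ ≤-refl
  where
  go : ∀ fuel k l₀ → k + l₀ < fuel → Euclid k (suc l₀)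
  go (suc _) zero l₀ _ = start l₀
  go (suc fuel) (suc k₀) l₀ (s≤s k+l<fuel) with l₀ <? suc k₀
  ... | yes l<k with d , l+d≡k ← m≤n⇒∃[o]m+o≡n l<k =
    subst (λ k → Euclid k (suc l₀)) (trans (+-comm d (suc l₀)) l+d≡k)
      (addRows (go fuel d l₀ (≤-<-trans (≤-reflexive d+l≡k₀) (≤-<-trans (m≤m+n k₀ l₀) k+l<fuel))))
    where
    d+l≡k₀ : d + l₀ ≡ k₀
    d+l≡k₀ = suc-injective (trans (sym (+-suc d l₀)) (trans (+-comm d (suc l₀)) l+d≡k))
  ... | no  l≮k with d , k+d≡l ← m≤n⇒∃[o]m+o≡n (≮⇒≥ l≮k) =
    subst (Euclid (suc k₀)) (trans (+-suc (suc k₀) d) (cong suc k+d≡l))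
      (addCols (go fuel (suc k₀) d (≤-<-trans (≤-reflexive k+d≡l) (≤-<-trans (m≤n+m l₀ k₀) k+l<fuel))))

isDefectTrade : ∀ {k l} → Euclid k l → ∃ (IsDefectTrade k l)
isDefectTrade (start l₀) = _ , column₀-isDefectTrade l₀
isDefectTrade (addRows e) = _ , GrowRows.isDefectTrade (proj₂ (isDefectTrade e))
isDefectTrade (addCols e) = _ , GrowColumns.isDefectTrade (proj₂ (isDefectTrade e))

2*m≡m+m : ∀ m → 2 * m ≡ m + m
2*m≡m+m m = cong (m +_) (+-identityʳ m)

3*m≡m+m+m : ∀ m → 3 * m ≡ m + m + m
3*m≡m+m+m m = trans (+-comm m (2 * m)) (cong (_+ m) (2*m≡m+m m))

T₀∪Block : ℕ → ℕ → ℕ → ℕ → ℕ → Set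
T₀∪Block m K C x y = (x ≡ 0 × y ≡ 0) ⊎ (x ≡ m × y ≡ 0) ⊎ (x ≡ m × y ≡ m) ⊎ (x ≡ m × y ≡ C)
                     ⊎ (x ≤ K × m ≤ y × y ≤ C)

module Embedding {k₀ l₀ : ℕ} {D : List Slot} (T : IsDefectTrade (suc k₀) (suc l₀) D) where
  private
    module T = IsDefectTrade T

  k l m n : ℕ
  k = suc k₀
  l = suc l₀
  m = k + l
  n = m + m + l

  lift : Maybe ℕ → ℕ
  lift nothing  = 0
  lift (just v) = m + v

  embed : Slot → Bicell
  embed e = bicell (i e) (m + j e) (m + (i e + j e)) (lift (mate e))

  t₀₀ tₘ₀ tₘₘ tₘₘ₊ₗ : Bicell
  t₀₀   = bicell 0 0 0 m
  tₘ₀   = bicell m 0 m 0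
  tₘₘ   = bicell m m (m + m) m
  tₘₘ₊ₗ = bicell m (m + l) 0 (m + m)

  E : List Bicell
  E = t₀₀ ∷ tₘ₀ ∷ tₘₘ ∷ tₘₘ₊ₗ ∷ map embed D

  Tₘₙ : List (Triple n)
  Tₘₙ = map (triple s) E

  ∈₀₀ : t₀₀ ∈ E
  ∈₀₀ = here refl
  ∈ₘ₀ : tₘ₀ ∈ E
  ∈ₘ₀ = there (here refl)
  ∈ₘₘ : tₘₘ ∈ E
  ∈ₘₘ = there (there (here refl))
  ∈ₘₘ₊ₗ : tₘₘ₊ₗ ∈ E
  ∈ₘₘ₊ₗ = there (there (there (here refl)))

  private
    data Member : Bicell → Set where
      is₀₀   : Member t₀₀
      isₘ₀   : Member tₘ₀
      isₘₘ   : Member tₘₘ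
      isₘₘ₊ₗ : Member tₘₘ₊ₗ
      inner  : ∀ {x y t} → slot x y t ∈ D → Member (bicell x (m + y) (m + (x + y)) (lift t))

    member : ∀ {b} → b ∈ E → Member b
    member (here refl)                         = is₀₀
    member (there (here refl))                 = isₘ₀
    member (there (there (here refl)))         = isₘₘ
    member (there (there (there (here refl)))) = isₘₘ₊ₗ
    member (there (there (there (there b∈)))) with ∈-map⁻ embed b∈
    ... | _ , e∈ , refl = inner e∈

    ∈inner : ∀ {x y t} → slot x y t ∈ D → bicell x (m + y) (m + (x + y)) (lift t) ∈ E
    ∈inner e∈ = there (there (there (there (∈-map⁺ embed e∈))))

    m+m<n : m + m < n
    m+m<n = m<m+n (m + m) z<s

    ≤m+m⇒<n : ∀ {v} → v ≤ m + m → v < n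
    ≤m+m⇒<n v≤ = ≤-<-trans v≤ m+m<n

    m+l<n : m + l < n
    m+l<n = +-monoˡ-< l (m<m+n m z<s)

    innerRow<m : ∀ {x y t} → slot x y t ∈ D → x < m
    innerRow<m e∈ = ≤-<-trans (proj₁ (T.bounded e∈)) (m<m+n k z<s)

    innerRow≢m : ∀ {x y t} → slot x y t ∈ D → x ≢ m
    innerRow≢m = <⇒≢ ∘ innerRow<m

    innerCol<n : ∀ {x y t} → slot x y t ∈ D → m + y < n
    innerCol<n e∈ = ≤-<-trans (+-monoʳ-≤ m (proj₂ (T.bounded e∈))) m+l<n

    innerSymbol<n : ∀ {x y t} → slot x y t ∈ D → m + (x + y) < n
    innerSymbol<n e∈ = ≤m+m⇒<n (+-monoʳ-≤ m (+-mono-≤ (proj₁ (T.bounded e∈)) (proj₂ (T.bounded e∈))))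

    lift<n : ∀ {x y t} → slot x y t ∈ D → lift t < n
    lift<n {t = nothing} _  = z<s
    lift<n {t = just v}  e∈ = ≤m+m⇒<n (+-monoʳ-≤ m (T.mate≤ e∈ refl))

    lift-injective : ∀ {t u} → lift t ≡ lift u → t ≡ u
    lift-injective {nothing} {nothing} _  = refl
    lift-injective {just v}  {just w}  eq = cong just (+-cancelˡ-≡ m v w eq)

    lift≢m : ∀ {x y t} → slot x y t ∈ D → lift t ≢ m
    lift≢m {t = just v} e∈ eq = T.mate≢0 e∈ (cong just (+-cancelˡ-≡ m v 0 (trans eq (sym (+-identityʳ m)))))

    lift≡m+m⇒corner : ∀ {x y t} → slot x y t ∈ D → lift t ≡ m + m → x ≡ k × y ≡ 0
    lift≡m+m⇒corner {t = just v} e∈ eq = T.top-position e∈ (cong just (+-cancelˡ-≡ m v m eq))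

    topColumn≢l : ∀ {x y t} → slot x y t ∈ D → lift t ≡ m + m → m + y ≢ m + l
    topColumn≢l e∈ p q with () ← trans (sym (proj₂ (lift≡m+m⇒corner e∈ p))) (+-cancelˡ-≡ m _ _ q)

    m<n : m < n
    m<n = ≤-<-trans (m≤m+n m m) m+m<n

    bounded : ∀ {b} → b ∈ E → r b < n × c b < n × s′ b < n
    bounded b∈ with member b∈
    ... | is₀₀      = z<s , z<s , m<n
    ... | isₘ₀      = m<n , z<s , z<s
    ... | isₘₘ      = m<n , m<n , m<n
    ... | isₘₘ₊ₗ    = m<n , m+l<n , m+m<n
    ... | inner e∈  = <-trans (innerRow<m e∈) m<n , innerCol<n e∈ , lift<n e∈

    s<n : ∀ {b} → b ∈ E → s b < n
    s<n b∈ with member b∈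
    ... | is₀₀      = z<s
    ... | isₘ₀      = m<n
    ... | isₘₘ      = m+m<n
    ... | isₘₘ₊ₗ    = z<s
    ... | inner e∈  = innerSymbol<n e∈

    isSum : ∀ {b} → b ∈ E → IsSumMod n (r b) (c b) (s b)
    isSum b∈ with member b∈
    ... | is₀₀                    = inj₁ refl
    ... | isₘ₀                    = inj₁ (+-identityʳ m)
    ... | isₘₘ                    = inj₁ refl
    ... | isₘₘ₊ₗ                  = inj₂ (sym (+-assoc m m l))
    ... | inner {x} {y} e∈        = inj₁ (x∙yz≈y∙xz x m y)

    s≢s′ : ∀ {b} → b ∈ E → s b ≢ s′ b
    s≢s′ b∈ with member b∈
    ... | is₀₀                 = λ ()
    ... | isₘ₀                 = λ ()
    ... | isₘₘ                 = m+1+n≢m m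
    ... | isₘₘ₊ₗ               = λ ()
    ... | inner {t = nothing} _  = λ ()
    ... | inner {t = just v}  e∈ = T.mate≢sum e∈ ∘ cong just ∘ sym ∘ +-cancelˡ-≡ m _ _

    distinct : DistinctPositions E
    distinct = ((λ { (() , _) }) ∷ (λ { (() , _) }) ∷ (λ { (() , _) })
                ∷ innerFrom t₀₀ (λ _ → λ { (_ , ()) }))
             ∷ ((λ { (_ , ()) }) ∷ (λ { (_ , ()) }) ∷ innerFrom tₘ₀ innerRow)
             ∷ ((m+1+n≢m m ∘ sym ∘ proj₂) ∷ innerFrom tₘₘ innerRow)
             ∷ innerFrom tₘₘ₊ₗ innerRow
             ∷ AllPairsₚ.map⁺ (AllPairs.map (λ apart (p , q) → apart (p , +-cancelˡ-≡ m _ _ q)) T.distinct)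
      where
      innerFrom : ∀ a → (∀ {e} → e ∈ D → ¬ SamePosition a (embed e)) →
                  All (λ b → ¬ SamePosition a b) (map embed D)
      innerFrom _ apart = Allₚ.map⁺ (All.tabulate apart)
      innerRow : ∀ {y e} → e ∈ D → ¬ (m ≡ i e × y ≡ m + j e)
      innerRow e∈ = innerRow≢m e∈ ∘ sym ∘ proj₁

    mate-rowInjective : ∀ {a b} → a ∈ E → b ∈ E → r a ≡ r b → s′ a ≡ s′ b → c a ≡ c b
    mate-rowInjective a∈ b∈ q p with member a∈ | member b∈
    ... | is₀₀     | is₀₀     = refl
    ... | is₀₀     | isₘ₀     = ⊥-elim (0≢1+n q)
    ... | is₀₀     | isₘₘ     = ⊥-elim (0≢1+n q)
    ... | is₀₀     | isₘₘ₊ₗ   = ⊥-elim (0≢1+n q)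
    ... | is₀₀     | inner e∈ = ⊥-elim (lift≢m e∈ (sym p))
    ... | isₘ₀     | is₀₀     = ⊥-elim (0≢1+n (sym q))
    ... | isₘ₀     | isₘ₀     = refl
    ... | isₘ₀     | isₘₘ     = ⊥-elim (0≢1+n p)
    ... | isₘ₀     | isₘₘ₊ₗ   = ⊥-elim (0≢1+n p)
    ... | isₘ₀     | inner e∈ = ⊥-elim (innerRow≢m e∈ (sym q))
    ... | isₘₘ     | is₀₀     = ⊥-elim (0≢1+n (sym q))
    ... | isₘₘ     | isₘ₀     = ⊥-elim (0≢1+n (sym p))
    ... | isₘₘ     | isₘₘ     = refl
    ... | isₘₘ     | isₘₘ₊ₗ   = ⊥-elim (m+1+n≢m m (sym p))
    ... | isₘₘ     | inner e∈ = ⊥-elim (innerRow≢m e∈ (sym q))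
    ... | isₘₘ₊ₗ   | is₀₀     = ⊥-elim (0≢1+n (sym q))
    ... | isₘₘ₊ₗ   | isₘ₀     = ⊥-elim (0≢1+n (sym p))
    ... | isₘₘ₊ₗ   | isₘₘ     = ⊥-elim (m+1+n≢m m p)
    ... | isₘₘ₊ₗ   | isₘₘ₊ₗ   = refl
    ... | isₘₘ₊ₗ   | inner e∈ = ⊥-elim (innerRow≢m e∈ (sym q))
    ... | inner e∈ | is₀₀     = ⊥-elim (lift≢m e∈ p)
    ... | inner e∈ | isₘ₀     = ⊥-elim (innerRow≢m e∈ q)
    ... | inner e∈ | isₘₘ     = ⊥-elim (innerRow≢m e∈ q)
    ... | inner e∈ | isₘₘ₊ₗ   = ⊥-elim (innerRow≢m e∈ q)
    ... | inner a₀∈ | inner b₀∈ = cong (m +_) (T.mate-rowInjective a₀∈ b₀∈ q (lift-injective p))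

    mate-colInjective : ∀ {a b} → a ∈ E → b ∈ E → c a ≡ c b → s′ a ≡ s′ b → r a ≡ r b
    mate-colInjective a∈ b∈ q p with member a∈ | member b∈
    ... | is₀₀     | is₀₀     = refl
    ... | is₀₀     | isₘ₀     = ⊥-elim (0≢1+n (sym p))
    ... | is₀₀     | isₘₘ     = ⊥-elim (0≢1+n q)
    ... | is₀₀     | isₘₘ₊ₗ   = ⊥-elim (0≢1+n q)
    ... | is₀₀     | inner _  = ⊥-elim (0≢1+n q)
    ... | isₘ₀     | is₀₀     = ⊥-elim (0≢1+n p)
    ... | isₘ₀     | isₘ₀     = refl
    ... | isₘ₀     | isₘₘ     = ⊥-elim (0≢1+n q)
    ... | isₘ₀     | isₘₘ₊ₗ   = ⊥-elim (0≢1+n q)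
    ... | isₘ₀     | inner _  = ⊥-elim (0≢1+n q)
    ... | isₘₘ     | is₀₀     = ⊥-elim (0≢1+n (sym q))
    ... | isₘₘ     | isₘ₀     = ⊥-elim (0≢1+n (sym q))
    ... | isₘₘ     | isₘₘ     = refl
    ... | isₘₘ     | isₘₘ₊ₗ   = ⊥-elim (m+1+n≢m m (sym q))
    ... | isₘₘ     | inner e∈ = ⊥-elim (lift≢m e∈ (sym p))
    ... | isₘₘ₊ₗ   | is₀₀     = ⊥-elim (0≢1+n (sym q))
    ... | isₘₘ₊ₗ   | isₘ₀     = ⊥-elim (0≢1+n (sym q))
    ... | isₘₘ₊ₗ   | isₘₘ     = ⊥-elim (m+1+n≢m m q)
    ... | isₘₘ₊ₗ   | isₘₘ₊ₗ   = refl
    ... | isₘₘ₊ₗ   | inner e∈ = ⊥-elim (topColumn≢l e∈ (sym p) (sym q))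
    ... | inner e∈ | is₀₀     = ⊥-elim (0≢1+n (sym q))
    ... | inner e∈ | isₘ₀     = ⊥-elim (0≢1+n (sym q))
    ... | inner e∈ | isₘₘ     = ⊥-elim (lift≢m e∈ p)
    ... | inner e∈ | isₘₘ₊ₗ   = ⊥-elim (topColumn≢l e∈ p q)
    ... | inner a₀∈ | inner b₀∈ = T.mate-colInjective a₀∈ b₀∈ (+-cancelˡ-≡ m _ _ q) (lift-injective p)

    row-s⊆s′ : ∀ {b} → b ∈ E → ∃ λ a → a ∈ E × r a ≡ r b × s′ a ≡ s b
    row-s⊆s′ b∈ with member b∈
    ... | is₀₀    = _ , ∈inner T.corner₀ₗ , refl , refl
    ... | isₘ₀    = _ , ∈ₘₘ , refl , refl
    ... | isₘₘ    = _ , ∈ₘₘ₊ₗ , refl , refl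
    ... | isₘₘ₊ₗ  = _ , ∈ₘ₀ , refl , refl
    ... | inner e∈ with T.row-sum⊆mate e∈
    ...   | inj₁ (refl , refl)      = _ , ∈₀₀ , refl , sym (+-identityʳ m)
    ...   | inj₂ (_ , e′∈ , p , q)  = _ , ∈inner e′∈ , p , cong lift q

    row-s′⊆s : ∀ {b} → b ∈ E → ∃ λ a → a ∈ E × r a ≡ r b × s a ≡ s′ b
    row-s′⊆s b∈ with member b∈
    ... | is₀₀    = _ , ∈inner (proj₂ T.corner₀₀) , refl , +-identityʳ m
    ... | isₘ₀    = _ , ∈ₘₘ₊ₗ , refl , refl
    ... | isₘₘ    = _ , ∈ₘ₀ , refl , refl
    ... | isₘₘ₊ₗ  = _ , ∈ₘₘ , refl , refl
    ... | inner e∈ with T.row-mate⊆sum e∈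
    ...   | inj₁ refl with refl , _ ← T.⋆-position e∈ refl = _ , ∈₀₀ , refl , refl
    ...   | inj₂ (_ , e′∈ , p , q) = _ , ∈inner e′∈ , p , sym (cong lift q)

    col-s⊆s′ : ∀ {b} → b ∈ E → ∃ λ a → a ∈ E × c a ≡ c b × s′ a ≡ s b
    col-s⊆s′ b∈ with member b∈
    ... | is₀₀    = _ , ∈ₘ₀ , refl , refl
    ... | isₘ₀    = _ , ∈₀₀ , refl , refl
    ... | isₘₘ    = _ , ∈inner T.cornerₖ₀ , +-identityʳ m , refl
    ... | isₘₘ₊ₗ  = _ , ∈inner T.corner₀ₗ , refl , refl
    ... | inner e∈ with T.col-sum⊆mate e∈
    ...   | inj₁ (refl , refl)         = _ , ∈ₘₘ , sym (+-identityʳ m) , sym (+-identityʳ m)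
    ...   | inj₂ (inj₁ (refl , refl))  = _ , ∈ₘₘ₊ₗ , refl , refl
    ...   | inj₂ (inj₂ (_ , e′∈ , p , q)) = _ , ∈inner e′∈ , cong (m +_) p , cong lift q

    col-s′⊆s : ∀ {b} → b ∈ E → ∃ λ a → a ∈ E × c a ≡ c b × s a ≡ s′ b
    col-s′⊆s b∈ with member b∈
    ... | is₀₀    = _ , ∈ₘ₀ , refl , refl
    ... | isₘ₀    = _ , ∈₀₀ , refl , refl
    ... | isₘₘ    = _ , ∈inner (proj₂ T.corner₀₀) , +-identityʳ m , +-identityʳ m
    ... | isₘₘ₊ₗ  = _ , ∈inner (proj₂ T.cornerₖₗ) , refl , refl
    ... | inner e∈ with T.col-mate⊆sum e∈
    ...   | inj₁ refl with refl , refl ← T.top-position e∈ refl = _ , ∈ₘₘ , sym (+-identityʳ m) , refl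
    ...   | inj₂ (inj₁ refl) with refl , refl ← T.⋆-position e∈ refl = _ , ∈ₘₘ₊ₗ , refl , refl
    ...   | inj₂ (inj₂ (_ , e′∈ , p , q)) = _ , ∈inner e′∈ , cong (m +_) p , sym (cong lift q)

  isBitrade : IsBitrade n E
  isBitrade = record
    { mateLatin = record
      { bounded      = bounded
      ; distinct     = distinct
      ; rowInjective = mate-rowInjective
      ; colInjective = mate-colInjective
      }
    ; s<n      = s<n
    ; isSum    = isSum
    ; s≢s′     = s≢s′
    ; row-s⊆s′ = row-s⊆s′
    ; row-s′⊆s = row-s′⊆s
    ; col-s⊆s′ = col-s⊆s′
    ; col-s′⊆s = col-s′⊆s
    }

  private
    region : ∀ {b} → b ∈ E → T₀∪Block m k (m + l) (r b) (c b)
    region b∈ with member b∈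
    ... | is₀₀     = inj₁ (refl , refl)
    ... | isₘ₀     = inj₂ (inj₁ (refl , refl))
    ... | isₘₘ     = inj₂ (inj₂ (inj₁ (refl , refl)))
    ... | isₘₘ₊ₗ   = inj₂ (inj₂ (inj₂ (inj₁ (refl , refl))))
    ... | inner e∈ = let x≤k , y≤l = T.bounded e∈ in
      inj₂ (inj₂ (inj₂ (inj₂ (x≤k , m≤m+n m _ , +-monoʳ-≤ m y≤l))))

    n∸m≡m+l : n ∸ m ≡ m + l
    n∸m≡m+l = trans (cong (_∸ m) (+-assoc m m l)) (m+n∸m≡n m (m + l))

    3m∸n≡k : 3 * m ∸ n ≡ k
    3m∸n≡k = trans (cong (_∸ n) (3*m≡m+m+m m)) (trans ([m+n]∸[m+o]≡n∸o (m + m) m l) (m+n∸n≡m k l))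

  hasCellₘₙ₋ₘ : HasCell Tₘₙ m (n ∸ m)
  hasCellₘₙ₋ₘ = subst (HasCell Tₘₙ m) (sym n∸m≡m+l) (hasCell isBitrade ∈ₘₘ₊ₗ)

  trade-region : ∀ t → t ∈ Tₘₙ → T₀∪Block m (3 * m ∸ n) (n ∸ m) (toℕ (row t)) (toℕ (col t))
  trade-region t t∈ with _ , b∈ , eʳ , eᶜ ← ∈-triples⁻ isBitrade t∈ =
    subst₂ (λ K C → T₀∪Block m K C (toℕ (row t)) (toℕ (col t))) (sym 3m∸n≡k) (sym n∸m≡m+l)
      (subst₂ (T₀∪Block m k (m + l)) (sym eʳ) (sym eᶜ) (region b∈))

2*m<n⇒n≡m+m+suc : ∀ {m n} → 2 * m < n → ∃ λ l₀ → n ≡ m + m + suc l₀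
2*m<n⇒n≡m+m+suc {m} 2m<n with l₀ , eq ← m≤n⇒∃[o]m+o≡n 2m<n =
  l₀ , trans (sym eq) (trans (sym (+-suc (2 * m) l₀)) (cong (_+ suc l₀) (2*m≡m+m m)))

m+m+l<3*m⇒l<m : ∀ {m l} → m + m + l < 3 * m → l < m
m+m+l<3*m⇒l<m {m} {l} lt = +-cancelˡ-< (m + m) l m (subst (m + m + l <_) (3*m≡m+m+m m) lt)

decompose : ∀ {m n} → 2 * m < n → n < 3 * m →
            ∃₂ λ k₀ l₀ → m ≡ suc k₀ + suc l₀ × n ≡ m + m + suc l₀
decompose {m} 2m<n n<3m with l₀ , refl ← 2*m<n⇒n≡m+m+suc {m} 2m<n
                        with k₀ , eq ← m≤n⇒∃[o]m+o≡n (m+m+l<3*m⇒l<m {m} n<3m) =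
  k₀ , l₀ , trans (sym eq) (cong suc (+-comm (suc l₀) k₀)) , refl

lemma10 : (m n : ℕ) → 2 ≤ 2 * m → 2 * m < n → n < 3 * m →
    Σ (List (Triple n)) λ T → IsLatinTradeInB n T
      × HasCell T 0 0 × HasCell T m 0 × HasCell T m m × HasCell T m (n ∸ m)
      × (∀ t → t ∈ T →
          (toℕ (row t) ≡ 0 × toℕ (col t) ≡ 0)
          ⊎ (toℕ (row t) ≡ m × toℕ (col t) ≡ 0)
          ⊎ (toℕ (row t) ≡ m × toℕ (col t) ≡ m)
          ⊎ (toℕ (row t) ≡ m × toℕ (col t) ≡ n ∸ m)
          ⊎ (toℕ (row t) ≤ 3 * m ∸ n × m ≤ toℕ (col t) × toℕ (col t) ≤ n ∸ m))
lemma10 m n _ 2m<n n<3m with k₀ , l₀ , refl , refl ← decompose {m} {n} 2m<n n<3m =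
  let open Embedding (proj₂ (isDefectTrade (euclid (suc k₀) l₀))) hiding (m; n) in
  Tₘₙ
  , isLatinTrade isBitrade (λ ())
  , hasCell isBitrade ∈₀₀
  , hasCell isBitrade ∈ₘ₀
  , hasCell isBitrade ∈ₘₘ
  , hasCellₘₙ₋ₘ
  , trade-region
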